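{- Let $k_1,k_2,k_3$ be positive integers, $k=k_1+k_2+k_3$, and let $p_1,p_2,p_3>0$ with $p_1+p_2+p_3=1$. Consider a sequence of $n$ independent trials, each taking value $i\in\{1,2,3\}$ with probability $p_i$, and let $X^{(n)}$ be the number of $(k_1,k_2,k_3)$ patterns in it, with $P_{3,n}(m)=\mathbb{P}(X^{(n)}=m)$. Then \[ G_3(w,z):=\sum_{n\ge 0}\sum_{m\ge 0}P_{3,n}(m)\,w^m z^n=\frac{1-p_2z}{(1-z)(1-p_2z)-(w-1)p_1^{k_1}p_2^{k_2}p_3^{k_3}z^{k}}. \]
   Context: A $(k_1,k_2,k_3)$ pattern is an occurrence of a maximal run of at least $k_1$ consecutive $1$'s immediately followed by a maximal run of at least $k_2$ consecutive $2$'s immediately followed by a maximal run of at least $k_3$ consecutive $3$'s; $X^{(n)}$ counts such occurrences (e.g. for $k_1=2,k_2=1,k_3=2$ the sequence $223111233331121122233223311233312$ contains 3 of them). The empty sequence ($n=0$) has $X^{(0)}=0$. -}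

module Defs where

open import Level using (Level)
open import Data.Nat as ℕ using (ℕ; zero; suc; _∸_; _≤?_; _≟_)
open import Data.Fin using (Fin; zero; suc)
open import Data.Fin.Properties using () renaming (_≟_ to _≟ᶠ_)
open import Data.List using (List; []; _∷_; _++_; map; foldr; concatMap; upTo)
open import Data.Vec using (Vec; []; _∷_; toList)
open import Data.Product using (_×_; _,_)
open import Data.Bool using (Bool; true; false; if_then_else_; _∧_)
open import Relation.Nullary.Decidable using (⌊_⌋)
open import Algebra.Bundles using (CommutativeRing)

one two three : Fin 3
one   = zero
two   = suc zero
three = suc (suc zero)

runs : List (Fin 3) → List (Fin 3 × ℕ)
runs []       = []
runs (x ∷ xs) = add (runs xs)
  where
  add : List (Fin 3 × ℕ) → List (Fin 3 × ℕ)
  add []             = (x , 1) ∷ []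
  add ((y , l) ∷ rs) = if ⌊ x ≟ᶠ y ⌋ then (y , suc l) ∷ rs
                       else (x , 1) ∷ (y , l) ∷ rs

countTriples : ℕ → ℕ → ℕ → List (Fin 3 × ℕ) → ℕ
countTriples k₁ k₂ k₃ ((a , la) ∷ (b , lb) ∷ (c , lc) ∷ rs) =
  (if ⌊ a ≟ᶠ one ⌋ ∧ ⌊ k₁ ≤? la ⌋ ∧ ⌊ b ≟ᶠ two ⌋ ∧ ⌊ k₂ ≤? lb ⌋
        ∧ ⌊ c ≟ᶠ three ⌋ ∧ ⌊ k₃ ≤? lc ⌋ then 1 else 0)
  ℕ.+ countTriples k₁ k₂ k₃ ((b , lb) ∷ (c , lc) ∷ rs)
countTriples k₁ k₂ k₃ _ = 0

X : ℕ → ℕ → ℕ → {n : ℕ} → Vec (Fin 3) n → ℕ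
X k₁ k₂ k₃ s = countTriples k₁ k₂ k₃ (runs (toList s))

allSeqs : (n : ℕ) → List (Vec (Fin 3) n)
allSeqs zero    = [] ∷ []
allSeqs (suc n) = concatMap (λ x → map (x ∷_) (allSeqs n)) (one ∷ two ∷ three ∷ [])

-- Everything below is over an arbitrary commutative ring R of scalars
-- (the paper's setting is R = ℝ).

module OverRing {c ℓ : Level} (R : CommutativeRing c ℓ) where
  open CommutativeRing R public

  Σ : List Carrier → Carrier
  Σ = foldr _+_ 0#

  prob : Carrier → Carrier → Carrier → {n : ℕ} → Vec (Fin 3) n → Carrier
  prob p₁ p₂ p₃ []       = 1#
  prob p₁ p₂ p₃ (x ∷ s)  = pr x * prob p₁ p₂ p₃ s
    where
    pr : Fin 3 → Carrier
    pr zero             = p₁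
    pr (suc zero)       = p₂
    pr (suc (suc zero)) = p₃

  P3 : ℕ → ℕ → ℕ → Carrier → Carrier → Carrier → ℕ → ℕ → Carrier
  P3 k₁ k₂ k₃ p₁ p₂ p₃ n m =
    Σ (map (λ s → if ⌊ X k₁ k₂ k₃ s ≟ m ⌋ then prob p₁ p₂ p₃ s else 0#)
           (allSeqs n))

  -- Formal power series in two variables w, z over R:
  -- F m n is the coefficient of w^m z^n.

  PS : Set c
  PS = ℕ → ℕ → Carrier

  _≈ₛ_ : PS → PS → Set ℓ
  F ≈ₛ H = ∀ m n → F m n ≈ H m n

  _+ₛ_ : PS → PS → PS
  (F +ₛ H) m n = F m n + H m n

  -ₛ_ : PS → PS
  (-ₛ F) m n = - F m n

  _-ₛ_ : PS → PS → PS
  F -ₛ H = F +ₛ (-ₛ H)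

  _*ₛ_ : PS → PS → PS
  (F *ₛ H) m n =
    Σ (concatMap (λ i → map (λ j → F i j * H (m ∸ i) (n ∸ j)) (upTo (suc n)))
                 (upTo (suc m)))

  const : Carrier → PS
  const a zero zero = a
  const a _    _    = 0#

  wₛ zₛ : PS
  wₛ (suc zero) zero = 1#
  wₛ _          _    = 0#
  zₛ zero (suc zero) = 1#
  zₛ _    _          = 0#

  _^ₛ_ : PS → ℕ → PS
  F ^ₛ zero  = const 1#
  F ^ₛ suc e = F *ₛ (F ^ₛ e)

  _^ʳ_ : Carrier → ℕ → Carrier
  a ^ʳ zero  = 1#
  a ^ʳ suc e = a * (a ^ʳ e)

  G3 : ℕ → ℕ → ℕ → Carrier → Carrier → Carrier → PS
  G3 k₁ k₂ k₃ p₁ p₂ p₃ m n = P3 k₁ k₂ k₃ p₁ p₂ p₃ n m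

  Num : Carrier → PS
  Num p₂ = const 1# -ₛ (const p₂ *ₛ zₛ)

  Den : ℕ → ℕ → ℕ → Carrier → Carrier → Carrier → PS
  Den k₁ k₂ k₃ p₁ p₂ p₃ =
    ((const 1# -ₛ zₛ) *ₛ (const 1# -ₛ (const p₂ *ₛ zₛ)))
    -ₛ ((wₛ -ₛ const 1#)
        *ₛ (const ((p₁ ^ʳ k₁) * (p₂ ^ʳ k₂) * (p₃ ^ʳ k₃))
            *ₛ (zₛ ^ₛ (k₁ ℕ.+ k₂ ℕ.+ k₃))))

module Submission where

-- Write G_n(m) = P(X⁽ⁿ⁾ = m). Deleting the first letter of a word lowers its count exactly
-- when the word begins 1^k₁ 2^(k₂+d) 3^k₃ for some d ≥ 0. Such a word has a 2 at position
-- k₁ (counting from 0), and deleting that 2 lowers d by one; the words with d = 0 are those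
-- with prefix 1^k₁ 2^k₂ 3^k₃. Comparing the counts after these three deletions gives an
-- identity valid for every word.
-- Its expectation over random words of length n + 2 is the recurrence, with c = p₁^k₁ p₂^k₂ p₃^k₃,
--   G_{n+2} − G_{n+1} = p₂ (G_{n+1} − G_n) + c (G_{n+2−k}(m − 1) − G_{n+2−k}(m)),
-- which, together with G_0 = G_1 = [m = 0], is the coefficientwise form of
--   G₃ · ((1 − z)(1 − p₂z) − (w − 1) c z^k) = 1 − p₂z.

open import Defs
open import Level using (Level)
open import Data.Nat using (ℕ; _≥_)
open import Algebra.Bundles using (CommutativeRing)
open import Data.Nat as ℕ using (zero; suc; _∸_; _≤_; _<_; z≤n; s≤s)
open import Data.Nat.Properties using (n∸n≡0; +-∸-assoc; ≤-pred; suc-injective; ≤-trans; m≤n+m)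
open import Data.Fin using (Fin)
open import Data.Fin.Properties using () renaming (_≟_ to _≟ᶠ_)
open import Data.List using (List; []; _∷_; _++_; map; concat; upTo; _∷ʳ_; replicate; drop; length)
open import Data.List.Properties using (map-++; map-∘; upTo-∷ʳ)
open import Data.List.Membership.Propositional using (_∈_)
open import Data.List.Membership.Propositional.Properties using (∈-upTo⁻)
open import Data.List.Relation.Unary.Any using (here; there)
open import Data.Vec using (Vec; toList)
open import Data.Maybe using (Maybe; just; nothing; maybe′)
open import Data.Maybe.Properties using (maybe′-map)
open import Data.Bool using (true; false; if_then_else_)
open import Data.Empty using (⊥-elim)
open import Function using (_∘_)
open import Relation.Nullary using (yes; no)
open import Relation.Nullary.Decidable using (⌊_⌋)
open import Relation.Binary.Bundles using (Setoid)
open import Relation.Binary.PropositionalEquality using (_≡_; _≢_)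
import Relation.Binary.PropositionalEquality as ≡
import Relation.Binary.Reasoning.Setoid as ≈-Reasoning

module Words where
  open import Data.Nat using (_+_; _≤?_)
  open import Data.Nat.Properties
    using ( ≤-refl; ≤-reflexive; ≤-antisym; <⇒≱; ≰⇒>; m≤n⇒m≤1+n; m≤m+n; m≤n⇒∃[o]m+o≡n
          ; +-assoc; +-suc; +-identityʳ; 1+n≢n)
  open import Data.List.Properties using (++-assoc; length-++; length-replicate)
  import Data.Maybe as Maybe
  open import Data.Product using (_×_; _,_; ∃; ∃₂)
  open import Data.Sum using (_⊎_; inj₁; inj₂; [_,_])
  open import Data.Bool using (_∧_)
  open import Algebra.Bundles using (CommutativeMonoid)
  open import Relation.Nullary using (Dec; ¬_; does; _×-dec_)
  open import Relation.Nullary.Decidable using (dec-true; dec-false)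
  open import Relation.Binary.PropositionalEquality using (refl; sym; trans; cong; cong₂; subst; subst₂; module ≡-Reasoning)

  Word : Set
  Word = List (Fin 3)

  unruns : List (Fin 3 × ℕ) → Word
  unruns []             = []
  unruns ((x , n) ∷ rs) = replicate n x ++ unruns rs

  unruns-runs : ∀ l → unruns (runs l) ≡ l
  unruns-runs [] = refl
  unruns-runs (x ∷ s) with runs s | unruns-runs s
  ... | []           | ih = cong (x ∷_) ih
  ... | (y , n) ∷ rs | ih with x ≟ᶠ y
  ...   | yes refl = cong (x ∷_) ih
  ...   | no _     = cong (x ∷_) ih

  runs-∷-[] : ∀ x s → runs s ≡ [] → runs (x ∷ s) ≡ (x , 1) ∷ []
  runs-∷-[] x s eq with runs s
  runs-∷-[] x s refl | .[] = refl

  runs-∷-≡ : ∀ x s {l rs} → runs s ≡ (x , l) ∷ rs → runs (x ∷ s) ≡ (x , suc l) ∷ rs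
  runs-∷-≡ x s eq with runs s
  runs-∷-≡ x s refl | .(_ ∷ _) with x ≟ᶠ x
  ... | yes _ = refl
  ... | no x≢x = ⊥-elim (x≢x refl)

  runs-∷-≢ : ∀ x s {y l rs} → runs s ≡ (y , l) ∷ rs → x ≢ y →
             runs (x ∷ s) ≡ (x , 1) ∷ (y , l) ∷ rs
  runs-∷-≢ x s {y} eq x≢y with runs s
  runs-∷-≢ x s {y} refl x≢y | .(_ ∷ _) with x ≟ᶠ y
  ... | yes x≡y = ⊥-elim (x≢y x≡y)
  ... | no _    = refl

  runs-replicate-[] : ∀ x {s} c → runs s ≡ [] → runs (replicate (suc c) x ++ s) ≡ (x , suc c) ∷ []
  runs-replicate-[] x {s} zero    eq = runs-∷-[] x s eq
  runs-replicate-[] x {s} (suc c) eq = runs-∷-≡ x (replicate (suc c) x ++ s) (runs-replicate-[] x c eq)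

  runs-replicate-≡ : ∀ x {s l rs} c → runs s ≡ (x , l) ∷ rs →
                     runs (replicate c x ++ s) ≡ (x , c + l) ∷ rs
  runs-replicate-≡ x zero    eq = eq
  runs-replicate-≡ x {s} (suc c) eq = runs-∷-≡ x (replicate c x ++ s) (runs-replicate-≡ x c eq)

  runs-replicate-≢ : ∀ x {s y l rs} c → runs s ≡ (y , l) ∷ rs → x ≢ y →
                     runs (replicate (suc c) x ++ s) ≡ (x , suc c) ∷ (y , l) ∷ rs
  runs-replicate-≢ x {s} zero    eq x≢y = runs-∷-≢ x s eq x≢y
  runs-replicate-≢ x {s} (suc c) eq x≢y = runs-∷-≡ x (replicate (suc c) x ++ s) (runs-replicate-≢ x c eq x≢y)

  replicate-+-++ : ∀ {A : Set} m n (x : A) ys →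
                   replicate (m + n) x ++ ys ≡ replicate m x ++ replicate n x ++ ys
  replicate-+-++ zero    n x ys = refl
  replicate-+-++ (suc m) n x ys = cong (x ∷_) (replicate-+-++ m n x ys)

  isYes≡does : ∀ {A : Set} (d : Dec A) → ⌊ d ⌋ ≡ does d
  isYes≡does (yes _) = refl
  isYes≡does (no _)  = refl

  -- A word with at most i letters has its last letter examined instead of the one at
  -- position i; this is what makes 𝔼-deleteTwo hold in every length.
  deleteTwo : ℕ → Word → Maybe Word
  deleteTwo i       []          = nothing
  deleteTwo zero    (x ∷ l)     = if ⌊ x ≟ᶠ two ⌋ then just l else nothing
  deleteTwo (suc i) (x ∷ [])    = deleteTwo zero (x ∷ [])
  deleteTwo (suc i) (x ∷ y ∷ l) = Maybe.map (x ∷_) (deleteTwo i (y ∷ l))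

  insertTwo : ℕ → Word → Word
  insertTwo zero    l       = two ∷ l
  insertTwo (suc i) []      = two ∷ []
  insertTwo (suc i) (x ∷ l) = x ∷ insertTwo i l

  deleteTwo-just : ∀ i l {r} → deleteTwo i l ≡ just r → l ≡ insertTwo i r
  deleteTwo-just zero (x ∷ l) eq with x ≟ᶠ two
  deleteTwo-just zero (x ∷ l) refl | yes refl = refl
  deleteTwo-just zero (x ∷ l) ()   | no _
  deleteTwo-just (suc i) (x ∷ []) eq with x ≟ᶠ two
  deleteTwo-just (suc i) (x ∷ []) refl | yes refl = refl
  deleteTwo-just (suc i) (x ∷ []) ()   | no _
  deleteTwo-just (suc i) (x ∷ y ∷ l) eq with deleteTwo i (y ∷ l) in del
  deleteTwo-just (suc i) (x ∷ y ∷ l) refl | just r = cong (x ∷_) (deleteTwo-just i (y ∷ l) del)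

  deleteTwo-ones : ∀ a r → deleteTwo a (replicate a one ++ two ∷ r) ≡ just (replicate a one ++ r)
  deleteTwo-ones zero          r = refl
  deleteTwo-ones (suc zero)    r = refl
  deleteTwo-ones (suc (suc a)) r = cong (Maybe.map (one ∷_)) (deleteTwo-ones (suc a) r)

  insertTwo-ones : ∀ a r → insertTwo a (replicate a one ++ r) ≡ replicate a one ++ two ∷ r
  insertTwo-ones zero    r = refl
  insertTwo-ones (suc a) r = cong (one ∷_) (insertTwo-ones a r)

  stripPrefix : Word → Word → Maybe Word
  stripPrefix []      l       = just l
  stripPrefix (x ∷ u) []      = nothing
  stripPrefix (x ∷ u) (y ∷ l) = if ⌊ x ≟ᶠ y ⌋ then stripPrefix u l else nothing

  stripPrefix-just : ∀ u l {r} → stripPrefix u l ≡ just r → l ≡ u ++ r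
  stripPrefix-just []      l refl = refl
  stripPrefix-just (x ∷ u) (y ∷ l) eq with x ≟ᶠ y
  ... | yes refl = cong (x ∷_) (stripPrefix-just u l eq)

  stripPrefix-++ : ∀ u v w → stripPrefix (u ++ v) (u ++ w) ≡ stripPrefix v w
  stripPrefix-++ []      v w = refl
  stripPrefix-++ (x ∷ u) v w with x ≟ᶠ x
  ... | yes _   = stripPrefix-++ u v w
  ... | no x≢x  = ⊥-elim (x≢x refl)

  stripPrefix-self : ∀ u w → stripPrefix u (u ++ w) ≡ just w
  stripPrefix-self []      w = refl
  stripPrefix-self (x ∷ u) w with x ≟ᶠ x
  ... | yes _  = stripPrefix-self u w
  ... | no x≢x = ⊥-elim (x≢x refl)

  stripPrefix-∷-≢ : ∀ {x y} u l → y ≢ x → stripPrefix (x ∷ u) (y ∷ l) ≡ nothing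
  stripPrefix-∷-≢ {x} {y} u l y≢x with x ≟ᶠ y
  ... | yes x≡y = ⊥-elim (y≢x (sym x≡y))
  ... | no _    = refl

  module Occurrences (k₁′ k₂′ k₃′ : ℕ) where

    k₁ k₂ k₃ K : ℕ
    k₁ = suc k₁′
    k₂ = suc k₂′
    k₃ = suc k₃′
    K  = k₁ + k₂ + k₃

    ct : List (Fin 3 × ℕ) → ℕ
    ct = countTriples k₁ k₂ k₃

    count : Word → ℕ
    count l = ct (runs l)

    Occurrence : (r s t : Fin 3 × ℕ) → Set
    Occurrence (a , la) (b , lb) (c , lc) =
      a ≡ one × k₁ ≤ la × b ≡ two × k₂ ≤ lb × c ≡ three × k₃ ≤ lc

    occurrence? : ∀ r s t → Dec (Occurrence r s t)
    occurrence? (a , la) (b , lb) (c , lc) =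
      a ≟ᶠ one ×-dec k₁ ≤? la ×-dec b ≟ᶠ two ×-dec k₂ ≤? lb ×-dec c ≟ᶠ three ×-dec k₃ ≤? lc

    ct-∷∷∷ : ∀ r s t rs →
             ct (r ∷ s ∷ t ∷ rs) ≡ (if does (occurrence? r s t) then 1 else 0) + ct (s ∷ t ∷ rs)
    ct-∷∷∷ (a , la) (b , lb) (c , lc) rs =
      cong (λ hit → (if hit then 1 else 0) + ct ((b , lb) ∷ (c , lc) ∷ rs))
        (cong₂ _∧_ (isYes≡does (a ≟ᶠ one)) (cong₂ _∧_ (isYes≡does (k₁ ≤? la))
          (cong₂ _∧_ (isYes≡does (b ≟ᶠ two)) (cong₂ _∧_ (isYes≡does (k₂ ≤? lb))
            (cong₂ _∧_ (isYes≡does (c ≟ᶠ three)) (isYes≡does (k₃ ≤? lc)))))))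

    ct-occ : ∀ {r s t} rs → Occurrence r s t → ct (r ∷ s ∷ t ∷ rs) ≡ suc (ct (s ∷ t ∷ rs))
    ct-occ {r} {s} {t} rs o = trans (ct-∷∷∷ r s t rs)
      (cong (λ hit → (if hit then 1 else 0) + ct (s ∷ t ∷ rs)) (dec-true (occurrence? r s t) o))

    ct-¬occ : ∀ {r s t} rs → ¬ Occurrence r s t → ct (r ∷ s ∷ t ∷ rs) ≡ ct (s ∷ t ∷ rs)
    ct-¬occ {r} {s} {t} rs ¬o = trans (ct-∷∷∷ r s t rs)
      (cong (λ hit → (if hit then 1 else 0) + ct (s ∷ t ∷ rs)) (dec-false (occurrence? r s t) ¬o))

    ct-∷-¬occ : ∀ r rs → (∀ {s t rs′} → rs ≡ s ∷ t ∷ rs′ → ¬ Occurrence r s t) → ct (r ∷ rs) ≡ ct rs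
    ct-∷-¬occ r []           _   = refl
    ct-∷-¬occ r (s ∷ [])     _   = refl
    ct-∷-¬occ r (s ∷ t ∷ rs) ¬o = ct-¬occ rs (¬o refl)

    ct-skip : ∀ a la rs → a ≢ one → ct ((a , la) ∷ rs) ≡ ct rs
    ct-skip a la rs a≢1 = ct-∷-¬occ _ rs λ { refl (a≡1 , _) → a≢1 a≡1 }

    ct-∷-0 : ∀ a rs → ct ((a , 0) ∷ rs) ≡ ct rs
    ct-∷-0 a rs = ct-∷-¬occ _ rs λ { refl (_ , () , _) }

    block : ℕ → ℕ → Word → Word
    block a b y = replicate a one ++ replicate b two ++ replicate k₃ three ++ y

    runs-threes : ∀ y → ∃₂ λ e rest →
                 runs (replicate k₃ three ++ y) ≡ (three , e) ∷ rest × k₃ ≤ e × count y ≡ ct rest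
    runs-threes y with runs y in eq
    ... | [] = k₃ , [] , runs-replicate-[] three k₃′ eq , ≤-refl , refl
    ... | (w , l) ∷ rs with w ≟ᶠ three
    ...   | yes refl = k₃ + l , rs , runs-replicate-≡ three k₃ eq , m≤m+n k₃ l , ct-skip three l rs λ ()
    ...   | no w≢3   = k₃ , (w , l) ∷ rs , runs-replicate-≢ three k₃′ eq (λ 3≡w → w≢3 (sym 3≡w)) , ≤-refl , refl

    ct-twos-threes : ∀ b e rs → ct ((two , b) ∷ (three , e) ∷ rs) ≡ ct rs
    ct-twos-threes b e rs = trans (ct-skip two b ((three , e) ∷ rs) λ ()) (ct-skip three e rs λ ())

    count-block-occ : ∀ a b y → k₁ ≤ a → k₂ ≤ b → count (block a b y) ≡ suc (count y)
    count-block-occ (suc a) (suc b) y k₁≤a k₂≤b with runs-threes y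
    ... | e , rest , threes , k₃≤e , count-y = begin
      count (block (suc a) (suc b) y)
        ≡⟨ cong ct (runs-replicate-≢ one a (runs-replicate-≢ two b threes λ ()) λ ()) ⟩
      ct ((one , suc a) ∷ (two , suc b) ∷ (three , e) ∷ rest)
        ≡⟨ ct-occ rest (refl , k₁≤a , refl , k₂≤b , refl , k₃≤e) ⟩
      suc (ct ((two , suc b) ∷ (three , e) ∷ rest))
        ≡⟨ cong suc (trans (ct-twos-threes (suc b) e rest) (sym count-y)) ⟩
      suc (count y) ∎
      where open ≡-Reasoning

    count-block-¬occ : ∀ a b y → a < k₁ ⊎ b < k₂ → count (block a b y) ≡ count y
    count-block-¬occ a b y short with runs-threes y
    ... | e , rest , threes , _ , count-y = trans (count≡ct-rest a b short) (sym count-y)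
      where
      count≡ct-rest : ∀ a b → a < k₁ ⊎ b < k₂ → count (block a b y) ≡ ct rest
      count≡ct-rest zero zero _ = trans (cong ct threes) (ct-skip three e rest λ ())
      count≡ct-rest zero (suc b) _ =
        trans (cong ct (runs-replicate-≢ two b threes λ ())) (ct-twos-threes (suc b) e rest)
      count≡ct-rest (suc a) zero _ = trans (cong ct (runs-replicate-≢ one a threes λ ()))
        (trans (ct-∷-¬occ (one , suc a) ((three , e) ∷ rest) λ { refl (_ , _ , () , _) }) (ct-skip three e rest λ ()))
      count≡ct-rest (suc a) (suc b) short =
        trans (cong ct (runs-replicate-≢ one a (runs-replicate-≢ two b threes λ ()) λ ()))
          (trans (ct-¬occ rest no-occurrence) (ct-twos-threes (suc b) e rest))
        where
        no-occurrence : ¬ Occurrence (one , suc a) (two , suc b) (three , e)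
        no-occurrence (_ , k₁≤a , _ , k₂≤b , _) =
          [ (λ a<k₁ → <⇒≱ a<k₁ k₁≤a) , (λ b<k₂ → <⇒≱ b<k₂ k₂≤b) ] short

    Leading : Word → Set
    Leading l = ∃₂ λ d y → l ≡ block k₁ (k₂ + d) y

    count-drop1-block : ∀ b y → count (drop 1 (block k₁ b y)) ≡ count y
    count-drop1-block b y = count-block-¬occ k₁′ b y (inj₁ ≤-refl)

    leading-count : ∀ {l} → Leading l → count l ≡ suc (count (drop 1 l))
    leading-count (d , y , refl) =
      trans (count-block-occ k₁ (k₂ + d) y ≤-refl (m≤m+n k₂ d)) (cong suc (sym (count-drop1-block (k₂ + d) y)))

    not-leading : ∀ {l} → count l ≡ count (drop 1 l) → ¬ Leading l
    not-leading same lead = 1+n≢n (trans (sym (leading-count lead)) same)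

    LeadingRuns : List (Fin 3 × ℕ) → Set
    LeadingRuns rs = ∃₂ λ s t → ∃ λ rs′ → rs ≡ (one , k₁) ∷ s ∷ t ∷ rs′ × Occurrence (one , k₁) s t

    runs-leading : ∀ l → LeadingRuns (runs l) → Leading l
    runs-leading l ((_ , lb) , (_ , lc) , rs , eq , (_ , _ , refl , k₂≤lb , refl , k₃≤lc))
      with m≤n⇒∃[o]m+o≡n k₂≤lb | m≤n⇒∃[o]m+o≡n k₃≤lc
    ... | d , refl | e , refl = d , replicate e three ++ unruns rs , (begin
      l                ≡⟨ unruns-runs l ⟨
      unruns (runs l)  ≡⟨ cong unruns eq ⟩
      replicate k₁ one ++ replicate (k₂ + d) two ++ replicate (k₃ + e) three ++ unruns rs
        ≡⟨ cong (λ w → replicate k₁ one ++ replicate (k₂ + d) two ++ w) (replicate-+-++ k₃ e three (unruns rs)) ⟩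
      block k₁ (k₂ + d) (replicate e three ++ unruns rs) ∎)
      where open ≡-Reasoning

    runs-∷ : ∀ x s → ∃₂ λ n rs → runs (x ∷ s) ≡ (x , suc n) ∷ rs × count s ≡ ct ((x , n) ∷ rs)
    runs-∷ x s with runs s
    ... | [] = 0 , [] , refl , refl
    ... | (y , n) ∷ rs with x ≟ᶠ y
    ...   | yes refl = n , rs , refl , refl
    ...   | no _     = 0 , (y , n) ∷ rs , refl , sym (ct-∷-0 x ((y , n) ∷ rs))

    ct-lengthen : ∀ x n rs → ct ((x , suc n) ∷ rs) ≡ ct ((x , n) ∷ rs) ⊎ LeadingRuns ((x , suc n) ∷ rs)
    ct-lengthen x n []           = inj₁ refl
    ct-lengthen x n (s ∷ [])     = inj₁ refl
    ct-lengthen x n (s ∷ t ∷ rs) with occurrence? (x , suc n) s t | occurrence? (x , n) s t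
    ... | yes o | yes o′ = inj₁ (trans (ct-occ rs o) (sym (ct-occ rs o′)))
    ... | no ¬o | no ¬o′ = inj₁ (trans (ct-¬occ rs ¬o) (sym (ct-¬occ rs ¬o′)))
    ... | no ¬o | yes (x≡1 , k₁≤n , o′) = ⊥-elim (¬o (x≡1 , m≤n⇒m≤1+n k₁≤n , o′))
    ... | yes (refl , k₁≤1+n , o) | no ¬o′ =
      inj₂ (s , t , rs , cong (λ m → (one , m) ∷ s ∷ t ∷ rs) 1+n≡k₁ , refl , ≤-refl , o)
      where
      1+n≡k₁ : suc n ≡ k₁
      1+n≡k₁ = ≤-antisym (≰⇒> λ k₁≤n → ¬o′ (refl , k₁≤n , o)) k₁≤1+n

    count-drop1⊎leading : ∀ l → count l ≡ count (drop 1 l) ⊎ Leading l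
    count-drop1⊎leading []      = inj₁ refl
    count-drop1⊎leading (x ∷ s) with runs-∷ x s
    ... | n , rs , eq , count-s with ct-lengthen x n rs
    ...   | inj₁ same = inj₁ (trans (cong ct eq) (trans same (sym count-s)))
    ...   | inj₂ occ  = inj₂ (runs-leading (x ∷ s) (subst LeadingRuns (sym eq) occ))

    patternWord : Word
    patternWord = replicate k₁ one ++ replicate k₂ two ++ replicate k₃ three

    length-patternWord : length patternWord ≡ K
    length-patternWord = begin
      length patternWord
        ≡⟨ length-++ (replicate k₁ one) ⟩
      length (replicate k₁ one) + length (replicate k₂ two ++ replicate k₃ three)
        ≡⟨ cong₂ _+_ (length-replicate k₁)
                     (trans (length-++ (replicate k₂ two)) (cong₂ _+_ (length-replicate k₂) (length-replicate k₃))) ⟩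
      k₁ + (k₂ + k₃)
        ≡⟨ +-assoc k₁ k₂ k₃ ⟨
      K ∎
      where open ≡-Reasoning

    patternWord-++ : ∀ y → patternWord ++ y ≡ block k₁ (k₂ + 0) y
    patternWord-++ y = begin
      patternWord ++ y ≡⟨ ++-assoc (replicate k₁ one) _ y ⟩
      replicate k₁ one ++ (replicate k₂ two ++ replicate k₃ three) ++ y
        ≡⟨ cong (replicate k₁ one ++_) (++-assoc (replicate k₂ two) _ y) ⟩
      block k₁ k₂ y ≡⟨ cong (λ b → block k₁ b y) (+-identityʳ k₂) ⟨
      block k₁ (k₂ + 0) y ∎
      where open ≡-Reasoning

    stripPrefix-leading : ∀ l {y} → stripPrefix patternWord l ≡ just y → Leading l
    stripPrefix-leading l {y} eq = 0 , y , trans (stripPrefix-just patternWord l eq) (patternWord-++ y)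

    deleteTwo-leading : ∀ l {r} → deleteTwo k₁ l ≡ just r → Leading r → Leading l
    deleteTwo-leading l eq (d , y , refl) = suc d , y , (begin
      l ≡⟨ deleteTwo-just k₁ l eq ⟩
      insertTwo k₁ (block k₁ (k₂ + d) y) ≡⟨ insertTwo-ones k₁ _ ⟩
      block k₁ (suc (k₂ + d)) y ≡⟨ cong (λ b → block k₁ b y) (+-suc k₂ d) ⟨
      block k₁ (k₂ + suc d) y ∎)
      where open ≡-Reasoning

    module _ {a ℓ} (M : CommutativeMonoid a ℓ) where
      open CommutativeMonoid M using (_≈_; _∙_; ε; reflexive; setoid; commutativeSemigroup) renaming (Carrier to A)
      open import Algebra.Properties.CommutativeSemigroup commutativeSemigroup using (xy∙z≈yz∙x; xy∙z≈yx∙z)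
      open ≈-Reasoning setoid

      on : (Word → A) → Maybe Word → A
      on f = maybe′ f ε

      Balanced′ : (ℕ → A) → Word → Maybe Word → Maybe Word → Set ℓ
      Balanced′ φ l deleted stripped =
        φ (count l) ∙ on (φ ∘ count ∘ drop 1) deleted ∙ on (φ ∘ count) stripped ≈
        φ (count (drop 1 l)) ∙ on (φ ∘ count) deleted ∙ on (φ ∘ suc ∘ count) stripped

      Balanced : (ℕ → A) → Word → Set ℓ
      Balanced φ l = Balanced′ φ l (deleteTwo k₁ l) (stripPrefix patternWord l)

      leading-balanced : ∀ φ d y → Balanced φ (block k₁ (k₂ + d) y)
      leading-balanced φ zero y =
        subst₂ (Balanced′ φ l) (sym (deleteTwo-ones k₁ _)) (sym stripped) (begin
          φ (count l) ∙ φ (count (drop 1 r)) ∙ φ (count y)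
            ≡⟨ cong₂ (λ a b → φ a ∙ φ b ∙ φ (count y)) count-l count-r′ ⟩
          φ (suc (count y)) ∙ φ (count y) ∙ φ (count y)
            ≈⟨ xy∙z≈yz∙x _ _ _ ⟩
          φ (count y) ∙ φ (count y) ∙ φ (suc (count y))
            ≡⟨ cong₂ (λ a b → φ a ∙ φ b ∙ φ (suc (count y))) count-l′ count-r ⟨
          φ (count (drop 1 l)) ∙ φ (count r) ∙ φ (suc (count y)) ∎)
        where
        l = block k₁ (k₂ + 0) y
        r = block k₁ (k₂′ + 0) y
        count-l : count l ≡ suc (count y)
        count-l = count-block-occ k₁ (k₂ + 0) y ≤-refl (m≤m+n k₂ 0)
        count-l′ : count (drop 1 l) ≡ count y
        count-l′ = count-drop1-block (k₂ + 0) y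
        count-r : count r ≡ count y
        count-r = count-block-¬occ k₁ (k₂′ + 0) y (inj₂ (s≤s (≤-reflexive (+-identityʳ k₂′))))
        count-r′ : count (drop 1 r) ≡ count y
        count-r′ = count-drop1-block (k₂′ + 0) y
        stripped : stripPrefix patternWord l ≡ just y
        stripped = trans (cong (stripPrefix patternWord) (sym (patternWord-++ y))) (stripPrefix-self patternWord y)
      leading-balanced φ (suc d) y =
        subst₂ (Balanced′ φ l) (sym (deleteTwo-ones k₁ _)) (sym stripped) (begin
          φ (count l) ∙ φ (count (drop 1 r)) ∙ ε  ≡⟨ cong₂ (λ a b → φ a ∙ φ b ∙ ε) count-l count-r′ ⟩
          φ (suc (count y)) ∙ φ (count y) ∙ ε     ≈⟨ xy∙z≈yx∙z _ _ _ ⟩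
          φ (count y) ∙ φ (suc (count y)) ∙ ε     ≡⟨ cong₂ (λ a b → φ a ∙ φ b ∙ ε) count-l′ count-r ⟨
          φ (count (drop 1 l)) ∙ φ (count r) ∙ ε  ∎)
        where
        l = block k₁ (k₂ + suc d) y
        r = block k₁ (k₂′ + suc d) y
        count-l : count l ≡ suc (count y)
        count-l = count-block-occ k₁ (k₂ + suc d) y ≤-refl (m≤m+n k₂ (suc d))
        count-l′ : count (drop 1 l) ≡ count y
        count-l′ = count-drop1-block (k₂ + suc d) y
        count-r : count r ≡ suc (count y)
        count-r = count-block-occ k₁ (k₂′ + suc d) y ≤-refl (subst (k₂ ≤_) (sym (+-suc k₂′ d)) (s≤s (m≤m+n k₂′ d)))
        count-r′ : count (drop 1 r) ≡ count y
        count-r′ = count-drop1-block (k₂′ + suc d) y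
        stripped : stripPrefix patternWord l ≡ nothing
        stripped = trans (cong (λ w → stripPrefix patternWord (replicate k₁ one ++ w)) (replicate-+-++ k₂ (suc d) two _))
          (trans (stripPrefix-++ (replicate k₁ one) _ _) (stripPrefix-++ (replicate k₂ two) _ _))

      balanced : ∀ φ l → Balanced φ l
      balanced φ l with count-drop1⊎leading l
      ... | inj₂ (d , y , refl) = leading-balanced φ d y
      ... | inj₁ same with stripPrefix patternWord l in stripped
      ...   | just _  = ⊥-elim (not-leading same (stripPrefix-leading l stripped))
      ...   | nothing with deleteTwo k₁ l in deleted
      ...     | nothing = reflexive (cong (λ n → φ n ∙ ε ∙ ε) same)
      ...     | just r with count-drop1⊎leading r
      ...       | inj₁ same′ = reflexive (cong₂ (λ n n′ → φ n ∙ φ n′ ∙ ε) same (sym same′))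
      ...       | inj₂ lead  = ⊥-elim (not-leading same (deleteTwo-leading l deleted lead))

open Words

module Sums {r ℓ : Level} (R : CommutativeRing r ℓ) where
  open OverRing R hiding (zero)
  open import Algebra.Properties.CommutativeSemigroup +-commutativeSemigroup using (interchange)

  Σ-++ : ∀ xs ys → Σ (xs ++ ys) ≈ Σ xs + Σ ys
  Σ-++ []       ys = sym (+-identityˡ _)
  Σ-++ (x ∷ xs) ys = trans (+-congˡ (Σ-++ xs ys)) (sym (+-assoc x (Σ xs) (Σ ys)))

  Σ-concat : ∀ xss → Σ (concat xss) ≈ Σ (map Σ xss)
  Σ-concat []         = refl
  Σ-concat (xs ∷ xss) = trans (Σ-++ xs (concat xss)) (+-congˡ (Σ-concat xss))

  module _ {A : Set} where

    Σ-map-cong : ∀ (xs : List A) {f g} → (∀ {x} → x ∈ xs → f x ≈ g x) → Σ (map f xs) ≈ Σ (map g xs)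
    Σ-map-cong []       f≈g = refl
    Σ-map-cong (x ∷ xs) f≈g = +-cong (f≈g (here ≡.refl)) (Σ-map-cong xs (f≈g ∘ there))

    Σ-map-0 : ∀ (xs : List A) {f} → (∀ {x} → x ∈ xs → f x ≈ 0#) → Σ (map f xs) ≈ 0#
    Σ-map-0 []       f≈0 = refl
    Σ-map-0 (x ∷ xs) f≈0 = trans (+-cong (f≈0 (here ≡.refl)) (Σ-map-0 xs (f≈0 ∘ there))) (+-identityʳ 0#)

    Σ-map-+ : ∀ (xs : List A) f g → Σ (map (λ x → f x + g x) xs) ≈ Σ (map f xs) + Σ (map g xs)
    Σ-map-+ []       f g = sym (+-identityʳ 0#)
    Σ-map-+ (x ∷ xs) f g = trans (+-congˡ (Σ-map-+ xs f g)) (interchange (f x) (g x) _ _)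

    Σ-map-*ˡ : ∀ (xs : List A) a f → Σ (map (λ x → a * f x) xs) ≈ a * Σ (map f xs)
    Σ-map-*ˡ []       a f = sym (zeroʳ a)
    Σ-map-*ˡ (x ∷ xs) a f = trans (+-congˡ (Σ-map-*ˡ xs a f)) (sym (distribˡ a (f x) _))

    Σ-map-*0 : ∀ (xs : List A) (f : A → Carrier) → Σ (map (λ x → f x * 0#) xs) ≈ 0#
    Σ-map-*0 xs f = Σ-map-0 xs {λ x → f x * 0#} λ _ → zeroʳ _

  Σ≤ : ℕ → (ℕ → Carrier) → Carrier
  Σ≤ m f = Σ (map f (upTo (suc m)))

  suc∸ : ∀ {m i} → i ∈ upTo (suc m) → suc m ∸ i ≡ suc (m ∸ i)
  suc∸ i∈ = +-∸-assoc 1 (≤-pred (∈-upTo⁻ i∈))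

  Σ≤-suc : ∀ m f → Σ≤ (suc m) f ≈ Σ≤ m f + f (suc m)
  Σ≤-suc m f = begin
    Σ≤ (suc m) f                                   ≡⟨ ≡.cong (Σ ∘ map f) (upTo-∷ʳ (suc m)) ⟨
    Σ (map f (upTo (suc m) ∷ʳ suc m))              ≡⟨ ≡.cong Σ (map-++ f (upTo (suc m)) _) ⟩
    Σ (map f (upTo (suc m)) ++ f (suc m) ∷ [])     ≈⟨ Σ-++ (map f (upTo (suc m))) _ ⟩
    Σ≤ m f + (f (suc m) + 0#)                      ≈⟨ +-congˡ (+-identityʳ (f (suc m))) ⟩
    Σ≤ m f + f (suc m)                             ∎
    where open ≈-Reasoning setoid

  Σ≤-∸-suc : ∀ m (f : ℕ → ℕ → Carrier) → (∀ i → f i 0 ≈ 0#) →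
             Σ≤ (suc m) (λ i → f i (suc m ∸ i)) ≈ Σ≤ m (λ i → f i (suc (m ∸ i)))
  Σ≤-∸-suc m f f-0 = begin
    Σ≤ (suc m) (λ i → f i (suc m ∸ i))                    ≈⟨ Σ≤-suc m _ ⟩
    Σ≤ m (λ i → f i (suc m ∸ i)) + f (suc m) (m ∸ m)
      ≈⟨ +-cong (Σ-map-cong (upTo (suc m)) λ i∈ → reflexive (≡.cong (f _) (suc∸ i∈)))
                (trans (reflexive (≡.cong (f (suc m)) (n∸n≡0 m))) (f-0 (suc m))) ⟩
    Σ≤ m (λ i → f i (suc (m ∸ i))) + 0#                  ≈⟨ +-identityʳ _ ⟩
    Σ≤ m (λ i → f i (suc (m ∸ i)))                       ∎
    where open ≈-Reasoning setoid

  Σ≤-∸-last : ∀ m (f : ℕ → ℕ → Carrier) → (∀ i k → f i (suc k) ≈ 0#) → Σ≤ m (λ i → f i (m ∸ i)) ≈ f m 0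
  Σ≤-∸-last zero    f f-suc = +-identityʳ (f 0 0)
  Σ≤-∸-last (suc m) f f-suc = begin
    Σ≤ (suc m) (λ i → f i (suc m ∸ i))                    ≈⟨ Σ≤-suc m _ ⟩
    Σ≤ m (λ i → f i (suc m ∸ i)) + f (suc m) (m ∸ m)
      ≈⟨ +-cong (Σ-map-0 (upTo (suc m)) λ i∈ → trans (reflexive (≡.cong (f _) (suc∸ i∈))) (f-suc _ _))
                (reflexive (≡.cong (f (suc m)) (n∸n≡0 m))) ⟩
    0# + f (suc m) 0                                      ≈⟨ +-identityˡ _ ⟩
    f (suc m) 0                                           ∎
    where open ≈-Reasoning setoid

module RingFacts {r ℓ : Level} (R : CommutativeRing r ℓ) where
  open CommutativeRing R
  open import Algebra.Properties.Ring ring using (-0#≈0#; -‿+-comm; x[y-z]≈xy-xz; ⁻¹-anti-homo‿-)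
  open import Algebra.Properties.CommutativeSemigroup +-commutativeSemigroup using (interchange)
  open ≈-Reasoning setoid

  x-0≈x : ∀ x → x - 0# ≈ x
  x-0≈x x = trans (+-congˡ -0#≈0#) (+-identityʳ x)

  [a-b]+[x-y]≈[a+x]-[b+y] : ∀ a b x y → (a - b) + (x - y) ≈ (a + x) - (b + y)
  [a-b]+[x-y]≈[a+x]-[b+y] a b x y = trans (interchange a (- b) x (- y)) (+-congˡ (-‿+-comm b y))

  [a-b]-p[b-d]-c[e-f]≈[a+pd+cf]-[b+pb+ce] : ∀ a b d p c e f →
    ((a - b) - p * (b - d)) - c * (e - f) ≈ (a + p * d + c * f) - (b + p * b + c * e)
  [a-b]-p[b-d]-c[e-f]≈[a+pd+cf]-[b+pb+ce] a b d p c e f = begin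
    ((a - b) - p * (b - d)) - c * (e - f)
      ≈⟨ +-cong (+-congˡ (-‿cong (x[y-z]≈xy-xz p b d))) (-‿cong (x[y-z]≈xy-xz c e f)) ⟩
    ((a - b) - (p * b - p * d)) - (c * e - c * f)
      ≈⟨ +-cong (+-congˡ (⁻¹-anti-homo‿- (p * b) (p * d))) (⁻¹-anti-homo‿- (c * e) (c * f)) ⟩
    ((a - b) + (p * d - p * b)) + (c * f - c * e)
      ≈⟨ +-congʳ ([a-b]+[x-y]≈[a+x]-[b+y] a b (p * d) (p * b)) ⟩
    ((a + p * d) - (b + p * b)) + (c * f - c * e)
      ≈⟨ [a-b]+[x-y]≈[a+x]-[b+y] (a + p * d) (b + p * b) (c * f) (c * e) ⟩
    (a + p * d + c * f) - (b + p * b + c * e) ∎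

module PowerSeries {r ℓ : Level} (R : CommutativeRing r ℓ) where
  open OverRing R hiding (zero)
  open Sums R
  open import Algebra.Properties.Ring ring using (-1*x≈-x)
  open import Algebra.Properties.CommutativeSemigroup *-commutativeSemigroup using (x∙yz≈y∙xz)

  ≈ₛ-setoid : Setoid r ℓ
  ≈ₛ-setoid = record
    { Carrier       = PS
    ; _≈_           = _≈ₛ_
    ; isEquivalence = record
      { refl  = λ _ _ → refl
      ; sym   = λ F≈H m n → sym (F≈H m n)
      ; trans = λ F≈H H≈K m n → trans (F≈H m n) (H≈K m n)
      }
    }

  open Setoid ≈ₛ-setoid public using () renaming (refl to ≈ₛ-refl; trans to ≈ₛ-trans)
  module ≈ₛ-Reasoning = ≈-Reasoning ≈ₛ-setoid

  _·ₛ_ : Carrier → PS → PS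
  (a ·ₛ F) m n = a * F m n

  w·_ : PS → PS
  (w· F) zero    n = 0#
  (w· F) (suc m) n = F m n

  delay : ℕ → (ℕ → Carrier) → ℕ → Carrier
  delay zero    f n       = f n
  delay (suc e) f zero    = 0#
  delay (suc e) f (suc n) = delay e f n

  z^_·_ : ℕ → PS → PS
  (z^ e · F) m = delay e (F m)

  infixr 25 _·ₛ_ w·_ z^_·_

  +ₛ-cong : ∀ {F F′ H H′} → F ≈ₛ F′ → H ≈ₛ H′ → (F +ₛ H) ≈ₛ (F′ +ₛ H′)
  +ₛ-cong F≈F′ H≈H′ m n = +-cong (F≈F′ m n) (H≈H′ m n)

  -ₛ-cong : ∀ {F F′ H H′} → F ≈ₛ F′ → H ≈ₛ H′ → (F -ₛ H) ≈ₛ (F′ -ₛ H′)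
  -ₛ-cong F≈F′ H≈H′ m n = +-cong (F≈F′ m n) (-‿cong (H≈H′ m n))

  ·ₛ-cong : ∀ a {F F′} → F ≈ₛ F′ → (a ·ₛ F) ≈ₛ (a ·ₛ F′)
  ·ₛ-cong a F≈F′ m n = *-congˡ (F≈F′ m n)

  w·-cong : ∀ {F F′} → F ≈ₛ F′ → (w· F) ≈ₛ (w· F′)
  w·-cong F≈F′ zero    n = refl
  w·-cong F≈F′ (suc m) n = F≈F′ m n

  delay-cong : ∀ e {f g} → (∀ j → f j ≈ g j) → ∀ n → delay e f n ≈ delay e g n
  delay-cong zero    f≈g n       = f≈g n
  delay-cong (suc e) f≈g zero    = refl
  delay-cong (suc e) f≈g (suc n) = delay-cong e f≈g n

  delay-< : ∀ e f {n} → n < e → delay e f n ≡ 0#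
  delay-< (suc e) f {zero}  _         = ≡.refl
  delay-< (suc e) f {suc n} (s≤s n<e) = delay-< e f n<e

  delay-linear : ∀ e a f g n → delay e (λ j → a * (f j - g j)) n ≈ a * (delay e f n - delay e g n)
  delay-linear zero    a f g n       = refl
  delay-linear (suc e) a f g zero    = sym (trans (*-congˡ (-‿inverseʳ 0#)) (zeroʳ a))
  delay-linear (suc e) a f g (suc n) = delay-linear e a f g n

  z^-cong : ∀ e {F F′} → F ≈ₛ F′ → (z^ e · F) ≈ₛ (z^ e · F′)
  z^-cong e F≈F′ m = delay-cong e (F≈F′ m)

  z^-suc : ∀ e F → (z^ suc e · F) ≈ₛ (z^ 1 · z^ e · F)
  z^-suc e F m zero    = refl
  z^-suc e F m (suc n) = refl

  z^-sucʳ : ∀ e F → (z^ e · z^ 1 · F) ≈ₛ (z^ suc e · F)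
  z^-sucʳ zero    F m n       = refl
  z^-sucʳ (suc e) F m zero    = refl
  z^-sucʳ (suc e) F m (suc n) = z^-sucʳ e F m n

  *ₛ-coeff : ∀ F H m n → (F *ₛ H) m n ≈ Σ≤ m λ i → Σ≤ n λ j → F i j * H (m ∸ i) (n ∸ j)
  *ₛ-coeff F H m n = trans (Σ-concat (map row (upTo (suc m)))) (reflexive (≡.cong Σ (≡.sym (map-∘ (upTo (suc m))))))
    where row = λ i → map (λ j → F i j * H (m ∸ i) (n ∸ j)) (upTo (suc n))

  *ₛ-congʳ : ∀ F {H H′} → H ≈ₛ H′ → (F *ₛ H) ≈ₛ (F *ₛ H′)
  *ₛ-congʳ F {H} {H′} H≈H′ m n = trans (*ₛ-coeff F H m n)
    (trans (Σ-map-cong (upTo (suc m)) λ _ → Σ-map-cong (upTo (suc n)) λ _ → *-congˡ (H≈H′ _ _)) (sym (*ₛ-coeff F H′ m n)))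

  *ₛ-distribˡ-+ₛ : ∀ F H K → (F *ₛ (H +ₛ K)) ≈ₛ ((F *ₛ H) +ₛ (F *ₛ K))
  *ₛ-distribˡ-+ₛ F H K m n = trans (*ₛ-coeff F (H +ₛ K) m n)
    (trans (Σ-map-cong (upTo (suc m)) λ _ → trans (Σ-map-cong (upTo (suc n)) λ _ → distribˡ _ _ _) (Σ-map-+ (upTo (suc n)) _ _))
      (trans (Σ-map-+ (upTo (suc m)) _ _) (sym (+-cong (*ₛ-coeff F H m n) (*ₛ-coeff F K m n)))))

  *ₛ-·ₛ : ∀ F a H → (F *ₛ (a ·ₛ H)) ≈ₛ (a ·ₛ (F *ₛ H))
  *ₛ-·ₛ F a H m n = trans (*ₛ-coeff F (a ·ₛ H) m n)
    (trans (Σ-map-cong (upTo (suc m)) λ _ →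
              trans (Σ-map-cong (upTo (suc n)) λ _ → x∙yz≈y∙xz _ a _) (Σ-map-*ˡ (upTo (suc n)) a _))
      (trans (Σ-map-*ˡ (upTo (suc m)) a _) (*-congˡ (sym (*ₛ-coeff F H m n)))))

  *ₛ-distribˡ-[-ₛ] : ∀ F H K → (F *ₛ (H -ₛ K)) ≈ₛ ((F *ₛ H) -ₛ (F *ₛ K))
  *ₛ-distribˡ-[-ₛ] F H K = begin
    F *ₛ (H +ₛ (-ₛ K))                ≈⟨ *ₛ-distribˡ-+ₛ F H (-ₛ K) ⟩
    (F *ₛ H) +ₛ (F *ₛ (-ₛ K))         ≈⟨ +ₛ-cong ≈ₛ-refl (*ₛ-congʳ F λ m n → sym (-1*x≈-x (K m n))) ⟩
    (F *ₛ H) +ₛ (F *ₛ ((- 1#) ·ₛ K))    ≈⟨ +ₛ-cong ≈ₛ-refl (*ₛ-·ₛ F (- 1#) K) ⟩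
    (F *ₛ H) +ₛ ((- 1#) ·ₛ (F *ₛ K))    ≈⟨ +ₛ-cong ≈ₛ-refl (λ m n → -1*x≈-x _) ⟩
    (F *ₛ H) -ₛ (F *ₛ K)              ∎
    where open ≈ₛ-Reasoning

  *ₛ-w· : ∀ F H → (F *ₛ w· H) ≈ₛ w· (F *ₛ H)
  *ₛ-w· F H zero n = trans (*ₛ-coeff F (w· H) 0 n) (trans (+-identityʳ _) (Σ-map-*0 (upTo (suc n)) (F 0)))
  *ₛ-w· F H (suc m) n = trans (*ₛ-coeff F (w· H) (suc m) n)
    (trans (Σ≤-∸-suc m (λ i k → Σ≤ n λ j → F i j * (w· H) k (n ∸ j))
                            (λ i → Σ-map-*0 (upTo (suc n)) (F i)))
      (sym (*ₛ-coeff F H m n)))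

  *ₛ-z¹ : ∀ F H → (F *ₛ z^ 1 · H) ≈ₛ z^ 1 · (F *ₛ H)
  *ₛ-z¹ F H m zero = trans (*ₛ-coeff F (z^ 1 · H) m 0)
    (Σ-map-0 (upTo (suc m)) λ _ → trans (+-identityʳ _) (zeroʳ _))
  *ₛ-z¹ F H m (suc n) = trans (*ₛ-coeff F (z^ 1 · H) m (suc n))
    (trans (Σ-map-cong (upTo (suc m)) λ {i} _ → Σ≤-∸-suc n (λ j k → F i j * (z^ 1 · H) (m ∸ i) k) (λ _ → zeroʳ _))
      (sym (*ₛ-coeff F H m n)))

  *ₛ-z^ : ∀ F e H → (F *ₛ z^ e · H) ≈ₛ z^ e · (F *ₛ H)
  *ₛ-z^ F zero    H = ≈ₛ-refl
  *ₛ-z^ F (suc e) H = begin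
    F *ₛ z^ suc e · H       ≈⟨ *ₛ-congʳ F (z^-suc e H) ⟩
    F *ₛ z^ 1 · z^ e · H    ≈⟨ *ₛ-z¹ F (z^ e · H) ⟩
    z^ 1 · (F *ₛ z^ e · H)  ≈⟨ z^-cong 1 (*ₛ-z^ F e H) ⟩
    z^ 1 · z^ e · (F *ₛ H)  ≈⟨ z^-suc e (F *ₛ H) ⟨
    z^ suc e · (F *ₛ H)     ∎
    where open ≈ₛ-Reasoning

  const-suc : ∀ a m n → const a m (suc n) ≡ 0#
  const-suc a zero    n = ≡.refl
  const-suc a (suc m) n = ≡.refl

  const-scale : ∀ a m n → a * const 1# m n ≈ const a m n
  const-scale a zero    zero    = *-identityʳ a
  const-scale a zero    (suc n) = zeroʳ a
  const-scale a (suc m) n       = zeroʳ a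

  *ₛ-const : ∀ F a → (F *ₛ const a) ≈ₛ (a ·ₛ F)
  *ₛ-const F a m n = trans (*ₛ-coeff F (const a) m n)
    (trans (Σ≤-∸-last m (λ i k → Σ≤ n λ j → F i j * const a k (n ∸ j))
                            (λ i k → Σ-map-*0 (upTo (suc n)) (F i)))
      (trans (Σ≤-∸-last n (λ j k → F m j * const a 0 k) (λ j k → zeroʳ _)) (*-comm (F m n) a)))

  *ₛ-identityʳ : ∀ F → (F *ₛ const 1#) ≈ₛ F
  *ₛ-identityʳ F m n = trans (*ₛ-const F 1# m n) (*-identityˡ (F m n))

  zₛ≈z¹ : zₛ ≈ₛ z^ 1 · const 1#
  zₛ≈z¹ zero    zero          = refl
  zₛ≈z¹ zero    (suc zero)    = refl
  zₛ≈z¹ zero    (suc (suc n)) = refl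
  zₛ≈z¹ (suc m) zero          = refl
  zₛ≈z¹ (suc m) (suc n)       = refl

  wₛ≈w· : wₛ ≈ₛ w· const 1#
  wₛ≈w· zero          n       = refl
  wₛ≈w· (suc zero)    zero    = refl
  wₛ≈w· (suc zero)    (suc n) = refl
  wₛ≈w· (suc (suc m)) n       = refl

  *ₛ-z^·1 : ∀ F e → (F *ₛ z^ e · const 1#) ≈ₛ z^ e · F
  *ₛ-z^·1 F e = begin
    F *ₛ z^ e · const 1#    ≈⟨ *ₛ-z^ F e (const 1#) ⟩
    z^ e · (F *ₛ const 1#)  ≈⟨ z^-cong e (*ₛ-identityʳ F) ⟩
    z^ e · F                ∎
    where open ≈ₛ-Reasoning

  *ₛ-zₛ : ∀ F → (F *ₛ zₛ) ≈ₛ z^ 1 · F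
  *ₛ-zₛ F = ≈ₛ-trans (*ₛ-congʳ F zₛ≈z¹) (*ₛ-z^·1 F 1)

  zₛ^ₛ≈z^ : ∀ e → (zₛ ^ₛ e) ≈ₛ z^ e · const 1#
  zₛ^ₛ≈z^ zero    = ≈ₛ-refl
  zₛ^ₛ≈z^ (suc e) = begin
    zₛ *ₛ (zₛ ^ₛ e)           ≈⟨ *ₛ-congʳ zₛ (zₛ^ₛ≈z^ e) ⟩
    zₛ *ₛ z^ e · const 1#     ≈⟨ *ₛ-z^·1 zₛ e ⟩
    z^ e · zₛ                 ≈⟨ z^-cong e zₛ≈z¹ ⟩
    z^ e · z^ 1 · const 1#    ≈⟨ z^-sucʳ e (const 1#) ⟩
    z^ suc e · const 1#       ∎
    where open ≈ₛ-Reasoning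

  *ₛ-Num : ∀ F p → (F *ₛ Num p) ≈ₛ (F -ₛ z^ 1 · p ·ₛ F)
  *ₛ-Num F p = begin
    F *ₛ Num p                                    ≈⟨ *ₛ-distribˡ-[-ₛ] F (const 1#) _ ⟩
    (F *ₛ const 1#) -ₛ (F *ₛ (const p *ₛ zₛ))     ≈⟨ -ₛ-cong (*ₛ-identityʳ F) (*ₛ-congʳ F (*ₛ-zₛ (const p))) ⟩
    F -ₛ (F *ₛ z^ 1 · const p)                    ≈⟨ -ₛ-cong ≈ₛ-refl (*ₛ-z^ F 1 (const p)) ⟩
    F -ₛ z^ 1 · (F *ₛ const p)                    ≈⟨ -ₛ-cong ≈ₛ-refl (z^-cong 1 (*ₛ-const F p)) ⟩
    F -ₛ z^ 1 · p ·ₛ F                            ∎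
    where open ≈ₛ-Reasoning

  *ₛ-[1-z] : ∀ F → (F *ₛ (const 1# -ₛ zₛ)) ≈ₛ (F -ₛ z^ 1 · F)
  *ₛ-[1-z] F = begin
    F *ₛ (const 1# -ₛ zₛ)            ≈⟨ *ₛ-distribˡ-[-ₛ] F (const 1#) zₛ ⟩
    (F *ₛ const 1#) -ₛ (F *ₛ zₛ)     ≈⟨ -ₛ-cong (*ₛ-identityʳ F) (*ₛ-zₛ F) ⟩
    F -ₛ z^ 1 · F                    ∎
    where open ≈ₛ-Reasoning

  *ₛ-[w-1] : ∀ F → (F *ₛ (wₛ -ₛ const 1#)) ≈ₛ (w· F -ₛ F)
  *ₛ-[w-1] F = begin
    F *ₛ (wₛ -ₛ const 1#)             ≈⟨ *ₛ-distribˡ-[-ₛ] F wₛ (const 1#) ⟩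
    (F *ₛ wₛ) -ₛ (F *ₛ const 1#)      ≈⟨ -ₛ-cong (*ₛ-congʳ F wₛ≈w·) (*ₛ-identityʳ F) ⟩
    (F *ₛ w· const 1#) -ₛ F           ≈⟨ -ₛ-cong (*ₛ-w· F (const 1#)) ≈ₛ-refl ⟩
    w· (F *ₛ const 1#) -ₛ F           ≈⟨ -ₛ-cong (w·-cong (*ₛ-identityʳ F)) ≈ₛ-refl ⟩
    w· F -ₛ F                         ∎
    where open ≈ₛ-Reasoning

  *ₛ-z^-·ₛ : ∀ F e a H → (F *ₛ z^ e · a ·ₛ H) ≈ₛ z^ e · a ·ₛ (F *ₛ H)
  *ₛ-z^-·ₛ F e a H = begin
    F *ₛ z^ e · a ·ₛ H      ≈⟨ *ₛ-z^ F e (a ·ₛ H) ⟩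
    z^ e · (F *ₛ a ·ₛ H)    ≈⟨ z^-cong e (*ₛ-·ₛ F a H) ⟩
    z^ e · a ·ₛ (F *ₛ H)    ∎
    where open ≈ₛ-Reasoning

  *ₛ-Den : ∀ F k₁ k₂ k₃ p₁ p₂ p₃ →
    let ∇F = F -ₛ z^ 1 · F
        c  = (p₁ ^ʳ k₁) * (p₂ ^ʳ k₂) * (p₃ ^ʳ k₃)
    in (F *ₛ Den k₁ k₂ k₃ p₁ p₂ p₃) ≈ₛ
       ((∇F -ₛ z^ 1 · p₂ ·ₛ ∇F) -ₛ z^ (k₁ ℕ.+ k₂ ℕ.+ k₃) · c ·ₛ (w· F -ₛ F))
  *ₛ-Den F k₁ k₂ k₃ p₁ p₂ p₃ = begin
    F *ₛ (((const 1# -ₛ zₛ) *ₛ Num p₂) -ₛ ((wₛ -ₛ const 1#) *ₛ (const c *ₛ (zₛ ^ₛ K))))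
      ≈⟨ *ₛ-distribˡ-[-ₛ] F _ _ ⟩
    (F *ₛ ((const 1# -ₛ zₛ) *ₛ Num p₂)) -ₛ (F *ₛ ((wₛ -ₛ const 1#) *ₛ (const c *ₛ (zₛ ^ₛ K))))
      ≈⟨ -ₛ-cong (*ₛ-congʳ F (*ₛ-Num (const 1# -ₛ zₛ) p₂)) (*ₛ-congʳ F [w-1]·c·zₛ^K) ⟩
    (F *ₛ ((const 1# -ₛ zₛ) -ₛ z^ 1 · p₂ ·ₛ (const 1# -ₛ zₛ))) -ₛ (F *ₛ z^ K · c ·ₛ (wₛ -ₛ const 1#))
      ≈⟨ -ₛ-cong (*ₛ-distribˡ-[-ₛ] F _ _) (*ₛ-z^-·ₛ F K c _) ⟩
    ((F *ₛ (const 1# -ₛ zₛ)) -ₛ (F *ₛ z^ 1 · p₂ ·ₛ (const 1# -ₛ zₛ))) -ₛ z^ K · c ·ₛ (F *ₛ (wₛ -ₛ const 1#))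
      ≈⟨ -ₛ-cong (-ₛ-cong ≈ₛ-refl (*ₛ-z^-·ₛ F 1 p₂ _)) (z^-cong K (·ₛ-cong c (*ₛ-[w-1] F))) ⟩
    ((F *ₛ (const 1# -ₛ zₛ)) -ₛ z^ 1 · p₂ ·ₛ (F *ₛ (const 1# -ₛ zₛ))) -ₛ z^ K · c ·ₛ (w· F -ₛ F)
      ≈⟨ -ₛ-cong (-ₛ-cong (*ₛ-[1-z] F) (z^-cong 1 (·ₛ-cong p₂ (*ₛ-[1-z] F)))) ≈ₛ-refl ⟩
    ((F -ₛ z^ 1 · F) -ₛ z^ 1 · p₂ ·ₛ (F -ₛ z^ 1 · F)) -ₛ z^ K · c ·ₛ (w· F -ₛ F) ∎
    where
    open ≈ₛ-Reasoning
    c = (p₁ ^ʳ k₁) * (p₂ ^ʳ k₂) * (p₃ ^ʳ k₃)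
    K = k₁ ℕ.+ k₂ ℕ.+ k₃
    [w-1]·c·zₛ^K : ((wₛ -ₛ const 1#) *ₛ (const c *ₛ (zₛ ^ₛ K))) ≈ₛ z^ K · c ·ₛ (wₛ -ₛ const 1#)
    [w-1]·c·zₛ^K = begin
      (wₛ -ₛ const 1#) *ₛ (const c *ₛ (zₛ ^ₛ K))  ≈⟨ *ₛ-congʳ _ (*ₛ-congʳ (const c) (zₛ^ₛ≈z^ K)) ⟩
      (wₛ -ₛ const 1#) *ₛ (const c *ₛ z^ K · const 1#)  ≈⟨ *ₛ-congʳ _ (*ₛ-z^·1 (const c) K) ⟩
      (wₛ -ₛ const 1#) *ₛ z^ K · const c  ≈⟨ *ₛ-z^ _ K (const c) ⟩
      z^ K · ((wₛ -ₛ const 1#) *ₛ const c)  ≈⟨ z^-cong K (*ₛ-const _ c) ⟩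
      z^ K · c ·ₛ (wₛ -ₛ const 1#)  ∎

module Expectation {r ℓ : Level} (R : CommutativeRing r ℓ) (p₁ p₂ p₃ : CommutativeRing.Carrier R) where
  open OverRing R hiding (zero)
  open Sums R
  open PowerSeries R using (delay)
  open import Algebra.Properties.CommutativeSemigroup *-commutativeSemigroup using (x∙yz≈y∙xz)

  weight : Fin 3 → Carrier
  weight Fin.zero                     = p₁
  weight (Fin.suc Fin.zero)           = p₂
  weight (Fin.suc (Fin.suc Fin.zero)) = p₃

  weightʷ : Word → Carrier
  weightʷ []      = 1#
  weightʷ (x ∷ u) = weight x * weightʷ u

  weightʷ-++ : ∀ u v → weightʷ (u ++ v) ≈ weightʷ u * weightʷ v
  weightʷ-++ []      v = sym (*-identityˡ _)
  weightʷ-++ (x ∷ u) v = trans (*-congˡ (weightʷ-++ u v)) (sym (*-assoc _ _ _))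

  weightʷ-replicate : ∀ n x → weightʷ (replicate n x) ≈ weight x ^ʳ n
  weightʷ-replicate zero    x = refl
  weightʷ-replicate (suc n) x = *-congˡ (weightʷ-replicate n x)

  prob-∷ : ∀ x {n} (s : Vec (Fin 3) n) → prob p₁ p₂ p₃ (x Data.Vec.∷ s) ≡ weight x * prob p₁ p₂ p₃ s
  prob-∷ Fin.zero                     s = ≡.refl
  prob-∷ (Fin.suc Fin.zero)           s = ≡.refl
  prob-∷ (Fin.suc (Fin.suc Fin.zero)) s = ≡.refl

  𝔼 : ℕ → (Word → Carrier) → Carrier
  𝔼 n f = Σ (map (λ s → f (toList s) * prob p₁ p₂ p₃ s) (allSeqs n))

  𝔼-cong : ∀ n {f g} → (∀ (s : Vec (Fin 3) n) → f (toList s) ≈ g (toList s)) → 𝔼 n f ≈ 𝔼 n g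
  𝔼-cong n f≈g = Σ-map-cong (allSeqs n) λ {s} _ → *-congʳ (f≈g s)

  𝔼-0 : ∀ n {f} → (∀ (s : Vec (Fin 3) n) → f (toList s) ≈ 0#) → 𝔼 n f ≈ 0#
  𝔼-0 n f≈0 = Σ-map-0 (allSeqs n) λ {s} _ → trans (*-congʳ (f≈0 s)) (zeroˡ _)

  𝔼-+ : ∀ n f g → 𝔼 n (λ l → f l + g l) ≈ 𝔼 n f + 𝔼 n g
  𝔼-+ n f g = trans (Σ-map-cong (allSeqs n) λ _ → distribʳ _ _ _) (Σ-map-+ (allSeqs n) _ _)

  𝔼-∷ : ∀ n (f : Word → Carrier) →
        𝔼 (suc n) f ≈ p₁ * 𝔼 n (f ∘ (one ∷_)) + (p₂ * 𝔼 n (f ∘ (two ∷_)) + p₃ * 𝔼 n (f ∘ (three ∷_)))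
  𝔼-∷ n f = trans (Σ-map-++ (branch one)) (+-cong (branch-sum one) (trans (Σ-map-++ (branch two))
              (+-cong (branch-sum two) (trans (Σ-map-++ (branch three)) (trans (+-identityʳ _) (branch-sum three))))))
    where
    h : Vec (Fin 3) (suc n) → Carrier
    h s = f (toList s) * prob p₁ p₂ p₃ s
    branch : Fin 3 → List (Vec (Fin 3) (suc n))
    branch x = map (x Data.Vec.∷_) (allSeqs n)
    Σ-map-++ : ∀ xs {ys} → Σ (map h (xs ++ ys)) ≈ Σ (map h xs) + Σ (map h ys)
    Σ-map-++ xs {ys} = trans (reflexive (≡.cong Σ (map-++ h xs ys))) (Σ-++ (map h xs) _)
    branch-sum : ∀ x → Σ (map h (branch x)) ≈ weight x * 𝔼 n (f ∘ (x ∷_))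
    branch-sum x = trans (reflexive (≡.cong Σ (≡.sym (map-∘ (allSeqs n)))))
      (trans (Σ-map-cong (allSeqs n) λ {s} _ → trans (*-congˡ (reflexive (prob-∷ x s))) (x∙yz≈y∙xz _ _ _))
        (Σ-map-*ˡ (allSeqs n) (weight x) _))

  𝔼-∷-only : ∀ n (f : Word → Carrier) x → (∀ {y} l → y ≢ x → f (y ∷ l) ≈ 0#) →
             𝔼 (suc n) f ≈ weight x * 𝔼 n (f ∘ (x ∷_))
  𝔼-∷-only n f x f≈0 = trans (𝔼-∷ n f) (only x f≈0)
    where
    vanish : ∀ y → (∀ l → f (y ∷ l) ≈ 0#) → weight y * 𝔼 n (f ∘ (y ∷_)) ≈ 0#
    vanish y f≈0 = trans (*-congˡ (𝔼-0 n {f ∘ (y ∷_)} λ s → f≈0 (toList s))) (zeroʳ _)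
    only : ∀ x → (∀ {y} l → y ≢ x → f (y ∷ l) ≈ 0#) →
           weight one * 𝔼 n (f ∘ (one ∷_)) + (weight two * 𝔼 n (f ∘ (two ∷_)) + weight three * 𝔼 n (f ∘ (three ∷_)))
             ≈ weight x * 𝔼 n (f ∘ (x ∷_))
    only Fin.zero f≈0 = trans (+-congˡ (trans
      (+-cong (vanish two λ l → f≈0 l λ ()) (vanish three λ l → f≈0 l λ ())) (+-identityʳ 0#))) (+-identityʳ _)
    only (Fin.suc Fin.zero) f≈0 = trans
      (+-cong (vanish one λ l → f≈0 l λ ()) (trans (+-congˡ (vanish three λ l → f≈0 l λ ())) (+-identityʳ _)))
      (+-identityˡ _)
    only (Fin.suc (Fin.suc Fin.zero)) f≈0 = trans
      (+-cong (vanish one λ l → f≈0 l λ ()) (trans (+-congʳ (vanish two λ l → f≈0 l λ ())) (+-identityˡ _)))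
      (+-identityˡ _)

  𝔼-drop1 : p₁ + p₂ + p₃ ≈ 1# → ∀ n f → 𝔼 (suc n) (f ∘ drop 1) ≈ 𝔼 n f
  𝔼-drop1 p₁+p₂+p₃≈1 n f = begin
    𝔼 (suc n) (f ∘ drop 1)                    ≈⟨ 𝔼-∷ n (f ∘ drop 1) ⟩
    p₁ * 𝔼 n f + (p₂ * 𝔼 n f + p₃ * 𝔼 n f)   ≈⟨ +-congˡ (distribʳ (𝔼 n f) p₂ p₃) ⟨
    p₁ * 𝔼 n f + (p₂ + p₃) * 𝔼 n f           ≈⟨ distribʳ (𝔼 n f) p₁ (p₂ + p₃) ⟨
    (p₁ + (p₂ + p₃)) * 𝔼 n f                 ≈⟨ *-congʳ (trans (sym (+-assoc p₁ p₂ p₃)) p₁+p₂+p₃≈1) ⟩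
    1# * 𝔼 n f                               ≈⟨ *-identityˡ (𝔼 n f) ⟩
    𝔼 n f                                    ∎
    where open ≈-Reasoning setoid

  𝔼-deleteTwo : ∀ i n (f : Word → Carrier) → 𝔼 (suc n) (maybe′ f 0# ∘ deleteTwo i) ≈ p₂ * 𝔼 n f
  𝔼-deleteTwo zero n f = 𝔼-∷-only n (maybe′ f 0# ∘ deleteTwo zero) two not-two
    where
    not-two : ∀ {y} l → y ≢ two → maybe′ f 0# (deleteTwo zero (y ∷ l)) ≈ 0#
    not-two {y} l y≢2 with y ≟ᶠ two
    ... | yes y≡2 = ⊥-elim (y≢2 y≡2)
    ... | no _    = refl
  𝔼-deleteTwo (suc i) zero    f = 𝔼-deleteTwo zero zero f
  𝔼-deleteTwo (suc i) (suc n) f = begin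
    𝔼 (suc (suc n)) g
      ≈⟨ 𝔼-∷ (suc n) g ⟩
    p₁ * 𝔼 (suc n) (g ∘ (one ∷_)) + (p₂ * 𝔼 (suc n) (g ∘ (two ∷_)) + p₃ * 𝔼 (suc n) (g ∘ (three ∷_)))
      ≈⟨ +-cong (*-congˡ (branch one)) (+-cong (*-congˡ (branch two)) (*-congˡ (branch three))) ⟩
    p₁ * (p₂ * 𝔼 n (f ∘ (one ∷_))) + (p₂ * (p₂ * 𝔼 n (f ∘ (two ∷_))) + p₃ * (p₂ * 𝔼 n (f ∘ (three ∷_))))
      ≈⟨ +-cong (x∙yz≈y∙xz p₁ p₂ _) (+-cong (x∙yz≈y∙xz p₂ p₂ _) (x∙yz≈y∙xz p₃ p₂ _)) ⟩
    p₂ * (p₁ * 𝔼 n (f ∘ (one ∷_))) + (p₂ * (p₂ * 𝔼 n (f ∘ (two ∷_))) + p₂ * (p₃ * 𝔼 n (f ∘ (three ∷_))))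
      ≈⟨ trans (distribˡ p₂ _ _) (+-congˡ (distribˡ p₂ _ _)) ⟨
    p₂ * (p₁ * 𝔼 n (f ∘ (one ∷_)) + (p₂ * 𝔼 n (f ∘ (two ∷_)) + p₃ * 𝔼 n (f ∘ (three ∷_))))
      ≈⟨ *-congˡ (𝔼-∷ n f) ⟨
    p₂ * 𝔼 (suc n) f ∎
    where
    open ≈-Reasoning setoid
    g = maybe′ f 0# ∘ deleteTwo (suc i)
    branch : ∀ x → 𝔼 (suc n) (g ∘ (x ∷_)) ≈ p₂ * 𝔼 n (f ∘ (x ∷_))
    branch x = trans (𝔼-cong (suc n) {g ∘ (x ∷_)} {maybe′ (f ∘ (x ∷_)) 0# ∘ deleteTwo i}
                       λ { (y Data.Vec.∷ s) → reflexive (maybe′-map f 0# (x ∷_) (deleteTwo i (y ∷ toList s))) })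
                     (𝔼-deleteTwo i n (f ∘ (x ∷_)))

  𝔼-stripPrefix : ∀ u n (f : Word → Carrier) →
                  𝔼 n (maybe′ f 0# ∘ stripPrefix u) ≈ weightʷ u * delay (length u) (λ j → 𝔼 j f) n
  𝔼-stripPrefix []      n       f = sym (*-identityˡ _)
  𝔼-stripPrefix (x ∷ u) zero    f = trans (trans (+-identityʳ _) (zeroˡ _)) (sym (zeroʳ _))
  𝔼-stripPrefix (x ∷ u) (suc n) f = begin
    𝔼 (suc n) (maybe′ f 0# ∘ stripPrefix (x ∷ u))
      ≈⟨ 𝔼-∷-only n (maybe′ f 0# ∘ stripPrefix (x ∷ u)) x
                   (λ l y≢x → reflexive (≡.cong (maybe′ f 0#) (stripPrefix-∷-≢ u l y≢x))) ⟩
    weight x * 𝔼 n (λ l → maybe′ f 0# (stripPrefix (x ∷ u) (x ∷ l)))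
      ≈⟨ *-congˡ (𝔼-cong n {λ l → maybe′ f 0# (stripPrefix (x ∷ u) (x ∷ l))} {maybe′ f 0# ∘ stripPrefix u}
                   λ s → reflexive (≡.cong (maybe′ f 0#) (stripPrefix-++ (x ∷ []) u (toList s)))) ⟩
    weight x * 𝔼 n (maybe′ f 0# ∘ stripPrefix u)
      ≈⟨ *-congˡ (𝔼-stripPrefix u n f) ⟩
    weight x * (weightʷ u * delay (length u) (λ j → 𝔼 j f) n)
      ≈⟨ *-assoc _ _ _ ⟨
    weightʷ (x ∷ u) * delay (length (x ∷ u)) (λ j → 𝔼 j f) (suc n) ∎
    where open ≈-Reasoning setoid

module Recurrence {r ℓ : Level} (R : CommutativeRing r ℓ) (k₁′ k₂′ k₃′ : ℕ)
                  (p₁ p₂ p₃ : CommutativeRing.Carrier R) where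
  open OverRing R hiding (zero)
  open Occurrences k₁′ k₂′ k₃′
  open Expectation R p₁ p₂ p₃
  open PowerSeries R using (delay)

  c : Carrier
  c = (p₁ ^ʳ k₁) * (p₂ ^ʳ k₂) * (p₃ ^ʳ k₃)

  weightʷ-patternWord : weightʷ patternWord ≈ c
  weightʷ-patternWord = begin
    weightʷ patternWord
      ≈⟨ trans (weightʷ-++ (replicate k₁ one) _) (*-congˡ (weightʷ-++ (replicate k₂ two) _)) ⟩
    weightʷ (replicate k₁ one) * (weightʷ (replicate k₂ two) * weightʷ (replicate k₃ three))
      ≈⟨ *-cong (weightʷ-replicate k₁ one) (*-cong (weightʷ-replicate k₂ two) (weightʷ-replicate k₃ three)) ⟩
    (p₁ ^ʳ k₁) * ((p₂ ^ʳ k₂) * (p₃ ^ʳ k₃))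
      ≈⟨ *-assoc _ _ _ ⟨
    c ∎
    where open ≈-Reasoning setoid

  law : (ℕ → Carrier) → ℕ → Carrier
  law φ n = 𝔼 n (φ ∘ count)

  𝔼-deletions : ∀ N (f g h : Word → Carrier) →
    𝔼 (suc (suc N)) (λ l → f l + maybe′ g 0# (deleteTwo k₁ l) + maybe′ h 0# (stripPrefix patternWord l))
      ≈ 𝔼 (suc (suc N)) f + p₂ * 𝔼 (suc N) g + c * delay K (λ j → 𝔼 j h) (suc (suc N))
  𝔼-deletions N f g h = begin
    𝔼 (suc (suc N)) (λ l → f l + maybe′ g 0# (deleteTwo k₁ l) + maybe′ h 0# (stripPrefix patternWord l))
      ≈⟨ trans (𝔼-+ (suc (suc N)) (λ l → f l + maybe′ g 0# (deleteTwo k₁ l)) (maybe′ h 0# ∘ stripPrefix patternWord))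
               (+-congʳ (𝔼-+ (suc (suc N)) f (maybe′ g 0# ∘ deleteTwo k₁))) ⟩
    𝔼 (suc (suc N)) f + 𝔼 (suc (suc N)) (maybe′ g 0# ∘ deleteTwo k₁)
      + 𝔼 (suc (suc N)) (maybe′ h 0# ∘ stripPrefix patternWord)
      ≈⟨ +-cong (+-congˡ (𝔼-deleteTwo k₁ (suc N) g)) (𝔼-stripPrefix patternWord (suc (suc N)) h) ⟩
    𝔼 (suc (suc N)) f + p₂ * 𝔼 (suc N) g + weightʷ patternWord * delay (length patternWord) (λ j → 𝔼 j h) (suc (suc N))
      ≈⟨ +-congˡ (*-cong weightʷ-patternWord
                         (reflexive (≡.cong (λ e → delay e (λ j → 𝔼 j h) (suc (suc N))) length-patternWord))) ⟩
    𝔼 (suc (suc N)) f + p₂ * 𝔼 (suc N) g + c * delay K (λ j → 𝔼 j h) (suc (suc N)) ∎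
    where open ≈-Reasoning setoid

  recurrence : p₁ + p₂ + p₃ ≈ 1# → ∀ φ N →
    law φ (suc (suc N)) + p₂ * law φ N + c * delay K (law φ) (suc (suc N)) ≈
    law φ (suc N) + p₂ * law φ (suc N) + c * delay K (law (φ ∘ suc)) (suc (suc N))
  recurrence p₁+p₂+p₃≈1 φ N = begin
    law φ (suc (suc N)) + p₂ * law φ N + c * delay K (law φ) (suc (suc N))
      ≈⟨ +-congʳ (+-congˡ (*-congˡ (𝔼-drop1 p₁+p₂+p₃≈1 N (φ ∘ count)))) ⟨
    𝔼 (suc (suc N)) (φ ∘ count) + p₂ * 𝔼 (suc N) (φ ∘ count ∘ drop 1) + c * delay K (law φ) (suc (suc N))
      ≈⟨ 𝔼-deletions N (φ ∘ count) (φ ∘ count ∘ drop 1) (φ ∘ count) ⟨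
    𝔼 (suc (suc N)) before
      ≈⟨ 𝔼-cong (suc (suc N)) {before} {after} (λ s → balanced +-commutativeMonoid φ (toList s)) ⟩
    𝔼 (suc (suc N)) after
      ≈⟨ 𝔼-deletions N (φ ∘ count ∘ drop 1) (φ ∘ count) (φ ∘ suc ∘ count) ⟩
    𝔼 (suc (suc N)) (φ ∘ count ∘ drop 1) + p₂ * law φ (suc N) + c * delay K (law (φ ∘ suc)) (suc (suc N))
      ≈⟨ +-congʳ (+-congʳ (𝔼-drop1 p₁+p₂+p₃≈1 (suc N) (φ ∘ count))) ⟩
    law φ (suc N) + p₂ * law φ (suc N) + c * delay K (law (φ ∘ suc)) (suc (suc N)) ∎
    where
    open ≈-Reasoning setoid
    before after : Word → Carrier
    before l = φ (count l) + maybe′ (φ ∘ count ∘ drop 1) 0# (deleteTwo k₁ l)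
               + maybe′ (φ ∘ count) 0# (stripPrefix patternWord l)
    after  l = φ (count (drop 1 l)) + maybe′ (φ ∘ count) 0# (deleteTwo k₁ l)
               + maybe′ (φ ∘ suc ∘ count) 0# (stripPrefix patternWord l)

module Coefficients {r ℓ : Level} (R : CommutativeRing r ℓ) (k₁′ k₂′ k₃′ : ℕ)
                    (p₁ p₂ p₃ : CommutativeRing.Carrier R) where
  open OverRing R hiding (zero)
  open Occurrences k₁′ k₂′ k₃′ using (k₁; k₂; k₃; K; count)
  open Sums R using (Σ-map-cong)
  open PowerSeries R
  open RingFacts R
  open Expectation R p₁ p₂ p₃ using (𝔼-cong; 𝔼-0; 𝔼-drop1)
  open Recurrence R k₁′ k₂′ k₃′ p₁ p₂ p₃ using (c; law; recurrence)
  open import Algebra.Properties.Ring ring using (x≈y⇒x∙y⁻¹≈ε)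

  G : PS
  G = G3 k₁ k₂ k₃ p₁ p₂ p₃

  δ : ℕ → ℕ → Carrier
  δ m x = if ⌊ x ℕ.≟ m ⌋ then 1# else 0#

  δ-suc : ∀ m x → δ (suc m) (suc x) ≡ δ m x
  δ-suc m x with x ℕ.≟ m | suc x ℕ.≟ suc m
  ... | yes _    | yes _    = ≡.refl
  ... | no _     | no _     = ≡.refl
  ... | yes x≡m  | no 1+x≢1+m = ⊥-elim (1+x≢1+m (≡.cong suc x≡m))
  ... | no x≢m   | yes 1+x≡1+m = ⊥-elim (x≢m (suc-injective 1+x≡1+m))

  G≈law : ∀ m n → G m n ≈ law (δ m) n
  G≈law m n = Σ-map-cong (allSeqs n) λ {s} _ → if-as-product ⌊ X k₁ k₂ k₃ s ℕ.≟ m ⌋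
    where
    if-as-product : ∀ b {q} → (if b then q else 0#) ≈ (if b then 1# else 0#) * q
    if-as-product true  = sym (*-identityˡ _)
    if-as-product false = sym (zeroˡ _)

  w·G≈law∘suc : ∀ m n → (w· G) m n ≈ law (δ m ∘ suc) n
  w·G≈law∘suc zero    n = sym (𝔼-0 n λ _ → refl)
  w·G≈law∘suc (suc m) n = trans (G≈law m n)
    (𝔼-cong n {δ m ∘ count} {δ (suc m) ∘ suc ∘ count} λ s → reflexive (≡.sym (δ-suc m (count (toList s)))))

  G-0 : ∀ m → G m 0 ≈ const 1# m 0
  G-0 zero    = +-identityʳ 1#
  G-0 (suc m) = +-identityʳ 0#

  G-1 : p₁ + p₂ + p₃ ≈ 1# → ∀ m → G m 1 ≈ G m 0
  G-1 p₁+p₂+p₃≈1 m = trans (G≈law m 1) (trans (𝔼-drop1 p₁+p₂+p₃≈1 0 (δ m ∘ count)) (sym (G≈law m 0)))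

  G-recurrence : p₁ + p₂ + p₃ ≈ 1# → ∀ m N →
    G m (suc (suc N)) + p₂ * G m N + c * delay K (G m) (suc (suc N)) ≈
    G m (suc N) + p₂ * G m (suc N) + c * delay K ((w· G) m) (suc (suc N))
  G-recurrence p₁+p₂+p₃≈1 m N = begin
    G m (suc (suc N)) + p₂ * G m N + c * delay K (G m) (suc (suc N))
      ≈⟨ terms (G≈law m (suc (suc N))) (G≈law m N) (delay-cong K (G≈law m) (suc (suc N))) ⟩
    law (δ m) (suc (suc N)) + p₂ * law (δ m) N + c * delay K (law (δ m)) (suc (suc N))
      ≈⟨ recurrence p₁+p₂+p₃≈1 (δ m) N ⟩
    law (δ m) (suc N) + p₂ * law (δ m) (suc N) + c * delay K (law (δ m ∘ suc)) (suc (suc N))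
      ≈⟨ terms (G≈law m (suc N)) (G≈law m (suc N)) (delay-cong K (w·G≈law∘suc m) (suc (suc N))) ⟨
    G m (suc N) + p₂ * G m (suc N) + c * delay K ((w· G) m) (suc (suc N)) ∎
    where
    open ≈-Reasoning setoid
    terms : ∀ {a a′ d d′ g g′} → a ≈ a′ → d ≈ d′ → g ≈ g′ → a + p₂ * d + c * g ≈ a′ + p₂ * d′ + c * g′
    terms a≈a′ d≈d′ g≈g′ = +-cong (+-cong a≈a′ (*-congˡ d≈d′)) (*-congˡ g≈g′)

  coefficients : p₁ + p₂ + p₃ ≈ 1# → let G′ = G -ₛ z^ 1 · G in
    ((G′ -ₛ z^ 1 · p₂ ·ₛ G′) -ₛ z^ K · c ·ₛ (w· G -ₛ G)) ≈ₛ (const 1# -ₛ z^ 1 · const p₂)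
  coefficients _ m zero = trans (x-0≈x _) (trans (x-0≈x _) (trans (x-0≈x _) (trans (G-0 m) (sym (x-0≈x _)))))
  coefficients p₁+p₂+p₃≈1 m (suc zero) = begin
    ((G m 1 - G m 0) - p₂ * (G m 0 - 0#)) - delay K _ 1
      ≈⟨ +-congˡ (-‿cong (reflexive (delay-< K _ 1<K))) ⟩
    ((G m 1 - G m 0) - p₂ * (G m 0 - 0#)) - 0#
      ≈⟨ x-0≈x _ ⟩
    (G m 1 - G m 0) - p₂ * (G m 0 - 0#)
      ≈⟨ +-cong (x≈y⇒x∙y⁻¹≈ε (G-1 p₁+p₂+p₃≈1 m)) (-‿cong (*-congˡ (x-0≈x (G m 0)))) ⟩
    0# - p₂ * G m 0
      ≈⟨ +-cong (reflexive (≡.sym (const-suc 1# m 0))) (-‿cong (trans (*-congˡ (G-0 m)) (const-scale p₂ m 0))) ⟩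
    const 1# m 1 - const p₂ m 0 ∎
    where
    open ≈-Reasoning setoid
    1<K : 1 < K
    1<K = s≤s (≤-trans (s≤s z≤n) (m≤n+m k₃ (k₁′ ℕ.+ k₂)))
  coefficients p₁+p₂+p₃≈1 m (suc (suc N)) = begin
    ((a - b) - p₂ * (b - d)) - delay K (λ j → c * ((w· G) m j - G m j)) (suc (suc N))
      ≈⟨ +-congˡ (-‿cong (delay-linear K c ((w· G) m) (G m) (suc (suc N)))) ⟩
    ((a - b) - p₂ * (b - d)) - c * (g′ - g)
      ≈⟨ [a-b]-p[b-d]-c[e-f]≈[a+pd+cf]-[b+pb+ce] a b d p₂ c g′ g ⟩
    (a + p₂ * d + c * g) - (b + p₂ * b + c * g′)
      ≈⟨ x≈y⇒x∙y⁻¹≈ε (G-recurrence p₁+p₂+p₃≈1 m N) ⟩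
    0#
      ≈⟨ x-0≈x 0# ⟨
    0# - 0#
      ≡⟨ ≡.cong₂ _-_ (const-suc 1# m (suc N)) (const-suc p₂ m N) ⟨
    const 1# m (suc (suc N)) - const p₂ m (suc N) ∎
    where
    open ≈-Reasoning setoid
    a = G m (suc (suc N))
    b = G m (suc N)
    d = G m N
    g = delay K (G m) (suc (suc N))
    g′ = delay K ((w· G) m) (suc (suc N))

proposition2 : ∀ {c ℓ : Level} (R : CommutativeRing c ℓ) →
    let open OverRing R in
    (k₁ k₂ k₃ : ℕ) → k₁ ≥ 1 → k₂ ≥ 1 → k₃ ≥ 1 →
    (p₁ p₂ p₃ : Carrier) → p₁ + p₂ + p₃ ≈ 1# →
    (G3 k₁ k₂ k₃ p₁ p₂ p₃ *ₛ Den k₁ k₂ k₃ p₁ p₂ p₃) ≈ₛ Num p₂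
proposition2 R (suc k₁′) (suc k₂′) (suc k₃′) (s≤s z≤n) (s≤s z≤n) (s≤s z≤n) p₁ p₂ p₃ p₁+p₂+p₃≈1 = begin
  G *ₛ Den k₁ k₂ k₃ p₁ p₂ p₃   ≈⟨ *ₛ-Den G k₁ k₂ k₃ p₁ p₂ p₃ ⟩
  _                             ≈⟨ coefficients p₁+p₂+p₃≈1 ⟩
  const 1# -ₛ z^ 1 · const p₂   ≈⟨ -ₛ-cong ≈ₛ-refl (*ₛ-zₛ (const p₂)) ⟨
  Num p₂                        ∎
  where
  open OverRing R
  open PowerSeries R
  open Occurrences k₁′ k₂′ k₃′ using (k₁; k₂; k₃)
  open Coefficients R k₁′ k₂′ k₃′ p₁ p₂ p₃
  open ≈ₛ-Reasoning
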